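{- Let $n>k\ge1$. For all $\lambda,\mu\in P_{kn}$, $$D_{\min}(\lambda,\mu)=\mathrm{diag}_0(\lambda)-D_{\max}(S^{n-k}(\lambda^\vee),\mu^\vee),\qquad D_{\max}(\lambda,\mu)=\mathrm{diag}_0(\lambda)-D_{\min}(S^{n-k}(\lambda^\vee),\mu^\vee).$$
   Context: $P_{kn}$ is the set of partitions $\lambda=(\lambda_1\ge\dots\ge\lambda_k\ge0)$ with $\lambda_1\le n-k$; $\lambda^\vee=(n-k-\lambda_k,\dots,n-k-\lambda_1)$; $\mathrm{diag}_0(\lambda)=\#\{i:\lambda_i\ge i\}$. The 01-word $(\omega_1,\dots,\omega_n)$ of $\lambda$ encodes the boundary path of its Young diagram in the $k\times(n-k)$ rectangle from lower-left to upper-right ($0$ = right step, $1$ = up step); $S(\lambda)$ is the partition with 01-word $(\omega_2,\dots,\omega_n,\omega_1)$ and $S^m$ its $m$-th power; $\phi_i(\lambda)=\omega_1+\dots+\omega_i$ for $1\le i\le n$, extended by $\phi_{i+n}(\lambda)=\phi_i(\lambda)+k$. $D_{\min}(\lambda,\mu)=-\min_{i+j=0}(\phi_i(\lambda)+\phi_j(\mu))$ and $D_{\max}(\lambda,\mu)=-\max_{i+j=k-n}(\phi_i(\lambda)+\phi_j(\mu))$, extrema over integers $i,j$. -}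

module Defs where

open import Data.Nat as ℕ using (ℕ; zero; suc; _∸_; _≤_; _≥_; _<_)
open import Data.Bool using (Bool; true; false; if_then_else_)
open import Data.List using (List; []; _∷_; _++_; [_]; replicate; reverse; map; length; take)
open import Data.Nat.ListAction using (sum)
open import Data.List.Relation.Unary.All using (All)
open import Data.List.Relation.Unary.Linked using (Linked)
open import Data.Integer as ℤ using (ℤ; +_; -_; _⊓_; _⊔_)
open import Data.Integer.DivMod using (_/ℕ_; _%ℕ_)
open import Data.Product using (_×_)
open import Relation.Binary.PropositionalEquality using (_≡_)
open import Relation.Nullary.Decidable using (does)
open import Function using (_∘_)

IsPart : ℕ → ℕ → List ℕ → Set
IsPart k n l = (length l ≡ k) × Linked _≥_ l × All (_≤ n ∸ k) l

dual : ℕ → ℕ → List ℕ → List ℕ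
dual k n l = reverse (map (λ x → (n ∸ k) ∸ x) l)

-- diag₀(λ) = #{ i : λᵢ ≥ i }  (indices starting at 1)
diag0From : ℕ → List ℕ → ℕ
diag0From i [] = 0
diag0From i (x ∷ xs) = (if does (i ℕ.≤? x) then 1 else 0) ℕ.+ diag0From (suc i) xs

diag0 : List ℕ → ℕ
diag0 = diag0From 1

-- 01-word of λ: boundary path in the k × (n-k) rectangle from lower-left to
-- upper-right, false (0) = right step, true (1) = up step.
-- Reading rows from the bottom (λₖ, …, λ₁): 0^{λₖ} 1 0^{λₖ₋₁-λₖ} 1 … 1 0^{n-k-λ₁}.
wordAux : ℕ → ℕ → List ℕ → List Bool
wordAux top prev [] = replicate (top ∸ prev) false
wordAux top prev (x ∷ xs) = replicate (x ∸ prev) false ++ (true ∷ wordAux top x xs)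

word : ℕ → ℕ → List ℕ → List Bool
word k n l = wordAux (n ∸ k) 0 (reverse l)

-- Partition with a given 01-word: the i-th up step (from below) is preceded by
-- λ_{k+1-i} right steps.
fromWordAux : ℕ → List Bool → List ℕ
fromWordAux z [] = []
fromWordAux z (false ∷ w) = fromWordAux (suc z) w
fromWordAux z (true ∷ w) = z ∷ fromWordAux z w

fromWord : List Bool → List ℕ
fromWord w = reverse (fromWordAux 0 w)

rotate : List Bool → List Bool
rotate [] = []
rotate (x ∷ xs) = xs ++ [ x ]

S : ℕ → ℕ → List ℕ → List ℕ
S k n l = fromWord (rotate (word k n l))

Spow : ℕ → ℕ → ℕ → List ℕ → List ℕ
Spow k n zero l = l
Spow k n (suc m) l = S k n (Spow k n m l)

bit : Bool → ℕ
bit true = 1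
bit false = 0

phiNat : ℕ → ℕ → List ℕ → ℕ → ℕ
phiNat k n l i = sum (map bit (take i (word k n l)))

-- extension to all integers by φ_{i+n} = φᵢ + k
-- (consistent since φ₀ = 0 and φₙ = k): φᵢ = φ_{i mod n} + (i div n)·k.
phi : (k n : ℕ) → .{{ℕ.NonZero n}} → List ℕ → ℤ → ℤ
phi k n l i = + phiNat k n l (i %ℕ n) ℤ.+ (i /ℕ n) ℤ.* (+ k)

minUpTo : (ℕ → ℤ) → ℕ → ℤ
minUpTo f zero = f 0
minUpTo f (suc m) = f (suc m) ⊓ minUpTo f m

maxUpTo : (ℕ → ℤ) → ℕ → ℤ
maxUpTo f zero = f 0
maxUpTo f (suc m) = f (suc m) ⊔ maxUpTo f m

-- D_min(λ,μ) = - min_{i+j=0} (φᵢ(λ) + φⱼ(μ)).  The function i ↦ φᵢ(λ)+φ_{-i}(μ)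
-- is n-periodic, so the minimum over ℤ equals the minimum over i = 0, …, n-1.
Dmin : (k n : ℕ) → .{{ℕ.NonZero n}} → List ℕ → List ℕ → ℤ
Dmin k n l m = - minUpTo (λ i → phi k n l (+ i) ℤ.+ phi k n m (- (+ i))) (n ∸ 1)

-- D_max(λ,μ) = - max_{i+j=k-n} (φᵢ(λ) + φⱼ(μ)), again n-periodic in i.
Dmax : (k n : ℕ) → .{{ℕ.NonZero n}} → List ℕ → List ℕ → ℤ
Dmax k n l m = - maxUpTo (λ i → phi k n l (+ i) ℤ.+ phi k n m ((+ k ℤ.- + n) ℤ.- (+ i))) (n ∸ 1)

-- Everything is read off 01-words. φ(λ) is the periodic extension φ_w of the prefix counts of the
-- word w of λ, and the operations on partitions become operations on words: λ^∨ reverses w and S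
-- rotates it, so that φ_{reverse w}(x) = -φ_w(-x) and φ_{rotate^j w}(x) = φ_w(x + j) - φ_w(j).
-- Moreover φ_w(k - n) = -diag₀(λ), because among the first k letters of w exactly k - diag₀(λ)
-- are up steps.  Substituting, every summand of D_max(S^{n-k}(λ^∨), μ^∨) is -diag₀(λ) minus a
-- summand of D_min(λ, μ) at the reflected index k - n - i, and the reflection permutes one period
-- of these n-periodic sums; the same holds with min and max exchanged.

module Submission where

open import Defs
open import Data.Nat using (ℕ; _<_; _≤_; NonZero)
open import Data.List using (List)
open import Data.Integer using (ℤ; +_; _-_)
open import Data.Product using (_×_)
open import Relation.Binary.PropositionalEquality using (_≡_)

open import Data.Bool using (Bool; true; false; not; if_then_else_)
open import Data.Empty using (⊥-elim)
open import Data.Integer as ℤ using (-_; _+_; _*_; _⊓_; _⊔_; 0ℤ; 1ℤ; +[1+_]; -[1+_])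
import Data.Integer.Properties as ℤ
open import Data.Integer.DivMod using (_/ℕ_; _%ℕ_; a≡a%ℕn+[a/ℕn]*n; n%ℕd<d)
open import Data.Integer.Tactic.RingSolver using (solve-∀)
open import Data.List using ([]; _∷_; _++_; [_]; take; drop; reverse; length; map; replicate)
import Data.List.Properties as List
open import Data.List.Relation.Binary.Permutation.Propositional using (_↭_; ↭-refl; ↭-sym; ↭-trans)
open import Data.List.Relation.Binary.Permutation.Propositional.Properties using (map⁺; ↭-length; ↭-reverse; ∷↭∷ʳ)
open import Data.List.Relation.Unary.All using (_∷_)
open import Data.List.Relation.Unary.Linked using (Linked; [-]; _∷_)
open import Data.Nat as ℕ using (zero; suc; _∸_; _≥_; z≤n; s≤s)
import Data.Nat.Properties as ℕ
import Data.Nat.Tactic.RingSolver as ℕ-Solver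
open import Data.Nat.ListAction using (sum)
open import Data.Nat.ListAction.Properties using (sum-++; sum-↭)
open import Data.Product using (_,_; ∃-syntax)
open import Data.Sum using (inj₁; inj₂)
open import Relation.Binary.PropositionalEquality using (refl; sym; trans; cong; cong₂; subst; module ≡-Reasoning)
open import Relation.Nullary using (Dec; yes; no; does; ¬_)
open import Relation.Nullary.Decidable using (dec-true; dec-false)

module _ {n : ℕ} where

  private
    nonzero-multiple-≥ : ∀ {r r′} m → + r ≡ + r′ + +[1+ m ] * + n → n ≤ r
    nonzero-multiple-≥ {r} {r′} m eq = begin
      n                   ≤⟨ ℕ.m≤n*m n (suc m) ⟩
      suc m ℕ.* n         ≤⟨ ℕ.m≤n+m _ r′ ⟩
      r′ ℕ.+ suc m ℕ.* n  ≡⟨ ℤ.+-injective (trans eq (cong (_+_ (+ r′)) (sym (ℤ.pos-* (suc m) n)))) ⟨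
      r                   ∎
      where open ℕ.≤-Reasoning

  +r≡+r′+d*n⇒d≡0 : ∀ {r r′} d → r < n → r′ < n → + r ≡ + r′ + d * + n → d ≡ 0ℤ
  +r≡+r′+d*n⇒d≡0 (+ zero) _ _ _ = refl
  +r≡+r′+d*n⇒d≡0 +[1+ m ] r<n _ eq = ⊥-elim (ℕ.<⇒≱ r<n (nonzero-multiple-≥ m eq))
  +r≡+r′+d*n⇒d≡0 {r} {r′} -[1+ m ] _ r′<n eq = ⊥-elim (ℕ.<⇒≱ r′<n (nonzero-multiple-≥ m eq′))
    where
      cancel : ∀ a d n → a ≡ (a + (- d) * n) + d * n
      cancel = solve-∀
      eq′ : + r′ ≡ + r + +[1+ m ] * + n
      eq′ = trans (cancel (+ r′) +[1+ m ] (+ n)) (cong (_+ +[1+ m ] * + n) (sym eq))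

  divMod-unique : ∀ {r r′} q q′ → r < n → r′ < n → + r + q * + n ≡ + r′ + q′ * + n → r ≡ r′ × q ≡ q′
  divMod-unique {r} {r′} q q′ r<n r′<n eq = ℤ.+-injective r≡r′ , q≡q′
    where
      difference : + r ≡ + r′ + (q′ - q) * + n
      difference = trans (regroup₁ (+ r) q (+ n)) (trans (cong (_- q * + n) eq) (regroup₂ (+ r′) q′ q (+ n)))
        where
          regroup₁ : ∀ a q n → a ≡ (a + q * n) - q * n
          regroup₁ = solve-∀
          regroup₂ : ∀ a q′ q n → (a + q′ * n) - q * n ≡ a + (q′ - q) * n
          regroup₂ = solve-∀
      q′-q≡0 : q′ - q ≡ 0ℤ
      q′-q≡0 = +r≡+r′+d*n⇒d≡0 (q′ - q) r<n r′<n difference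
      r≡r′ : + r ≡ + r′
      r≡r′ = trans difference (trans (cong (λ d → + r′ + d * + n) q′-q≡0) (ℤ.+-identityʳ (+ r′)))
      q≡q′ : q ≡ q′
      q≡q′ = sym (trans (regroup q′ q) (trans (cong (_+_ q) q′-q≡0) (ℤ.+-identityʳ q)))
        where
          regroup : ∀ q′ q → q′ ≡ q + (q′ - q)
          regroup = solve-∀

  %ℕ-/ℕ-unique : .{{_ : NonZero n}} → ∀ x {r} q → r < n → x ≡ + r + q * + n → x %ℕ n ≡ r × x /ℕ n ≡ q
  %ℕ-/ℕ-unique x q r<n eq = divMod-unique (x /ℕ n) q (n%ℕd<d x n) r<n (trans (sym (a≡a%ℕn+[a/ℕn]*n x n)) eq)

ones : List Bool → ℕ
ones w = sum (map bit w)

zeros : List Bool → ℕ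
zeros w = ones (map not w)

ones-++ : ∀ xs ys → ones (xs ++ ys) ≡ ones xs ℕ.+ ones ys
ones-++ xs ys = trans (cong sum (List.map-++ bit xs ys)) (sum-++ (map bit xs) (map bit ys))

ones-↭ : ∀ {xs ys} → xs ↭ ys → ones xs ≡ ones ys
ones-↭ p = sum-↭ (map⁺ bit p)

zeros-↭ : ∀ {xs ys} → xs ↭ ys → zeros xs ≡ zeros ys
zeros-↭ p = ones-↭ (map⁺ not p)

length≡zeros+ones : ∀ w → length w ≡ zeros w ℕ.+ ones w
length≡zeros+ones [] = refl
length≡zeros+ones (false ∷ w) = cong suc (length≡zeros+ones w)
length≡zeros+ones (true ∷ w) = trans (cong suc (length≡zeros+ones w)) (sym (ℕ.+-suc (zeros w) (ones w)))

ones-take-++ : ∀ s xs ys → ones (take s (xs ++ ys)) ≡ ones (take s xs) ℕ.+ ones (take (s ∸ length xs) ys)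
ones-take-++ zero xs ys = sym (cong (λ s → ones (take s ys)) (ℕ.0∸n≡0 (length xs)))
ones-take-++ (suc s) [] ys = refl
ones-take-++ (suc s) (x ∷ xs) ys =
  trans (cong (bit x ℕ.+_) (ones-take-++ s xs ys)) (sym (ℕ.+-assoc (bit x) _ _))

ones-take-≥ : ∀ {s} w → length w ≤ s → ones (take s w) ≡ ones w
ones-take-≥ {s} w len≤s = cong ones (List.take-all s w len≤s)

ones-take-replicate-false : ∀ s r → ones (take s (replicate r false)) ≡ 0
ones-take-replicate-false zero r = refl
ones-take-replicate-false (suc s) zero = refl
ones-take-replicate-false (suc s) (suc r) = ones-take-replicate-false s r

ones-take-length-++ : ∀ xs ys → ones (take (length xs) (xs ++ ys)) ≡ ones xs
ones-take-length-++ [] ys = refl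
ones-take-length-++ (x ∷ xs) ys = cong (bit x ℕ.+_) (ones-take-length-++ xs ys)

ones-take-reverse : ∀ w {r} → r ≤ length w → ones (take r (reverse w)) ℕ.+ ones (take (length w ∸ r) w) ≡ ones w
ones-take-reverse w {r} r≤len = begin
  ones (take r (reverse w)) ℕ.+ ones (take a w)
    ≡⟨ cong₂ (λ s v → ones (take s v) ℕ.+ ones (take a w)) (sym length-suffix) reverse-split ⟩
  ones (take (length (reverse (drop a w))) (reverse (drop a w) ++ reverse (take a w))) ℕ.+ ones (take a w)
    ≡⟨ cong (ℕ._+ ones (take a w)) (ones-take-length-++ (reverse (drop a w)) (reverse (take a w))) ⟩
  ones (reverse (drop a w)) ℕ.+ ones (take a w)
    ≡⟨ cong (ℕ._+ ones (take a w)) (ones-↭ (↭-reverse (drop a w))) ⟩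
  ones (drop a w) ℕ.+ ones (take a w)
    ≡⟨ ℕ.+-comm (ones (drop a w)) (ones (take a w)) ⟩
  ones (take a w) ℕ.+ ones (drop a w)
    ≡⟨ trans (cong ones (sym (List.take++drop≡id a w))) (ones-++ (take a w) (drop a w)) ⟨
  ones w ∎
  where
    open ≡-Reasoning
    a = length w ∸ r
    reverse-split : reverse w ≡ reverse (drop a w) ++ reverse (take a w)
    reverse-split = trans (cong reverse (sym (List.take++drop≡id a w))) (List.reverse-++ (take a w) (drop a w))
    length-suffix : length (reverse (drop a w)) ≡ r
    length-suffix = trans (List.length-reverse (drop a w)) (trans (List.length-drop a w) (ℕ.m∸[m∸n]≡n r≤len))

rotate-↭ : ∀ w → rotate w ↭ w
rotate-↭ [] = ↭-refl
rotate-↭ (x ∷ xs) = ↭-sym (∷↭∷ʳ x xs)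

rotate^ : ℕ → List Bool → List Bool
rotate^ zero w = w
rotate^ (suc j) w = rotate (rotate^ j w)

rotate^-↭ : ∀ j w → rotate^ j w ↭ w
rotate^-↭ zero w = ↭-refl
rotate^-↭ (suc j) w = ↭-trans (rotate-↭ (rotate^ j w)) (rotate^-↭ j w)

Is01Word : ℕ → ℕ → List Bool → Set
Is01Word k n w = length w ≡ n × ones w ≡ k

Is01Word-↭ : ∀ {k n xs ys} → xs ↭ ys → Is01Word k n ys → Is01Word k n xs
Is01Word-↭ p (length≡n , ones≡k) = trans (↭-length p) length≡n , trans (ones-↭ p) ones≡k

pos-∸ : ∀ {m n} → n ≤ m → + (m ∸ n) ≡ + m - + n
pos-∸ {m} {n} n≤m = sym (trans (ℤ.[+m]-[+n]≡m⊖n m n) (ℤ.⊖-≥ n≤m))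

pos-+-cancel : ∀ {a b c} → a ℕ.+ b ≡ c → + a ≡ + c - + b
pos-+-cancel {a} {b} eq = trans (regroup (+ a) (+ b)) (cong (_- + b) (trans (sym (ℤ.pos-+ a b)) (cong +_ eq)))
  where
    regroup : ∀ a b → a ≡ (a + b) - b
    regroup = solve-∀

Periodic : ℕ → (ℤ → ℤ) → Set
Periodic n F = ∀ y q → F (y + q * + n) ≡ F y

module PeriodicExtension (k n : ℕ) .{{_ : NonZero n}} where

  -- phi k n λ unfolds to φ (word k n λ).
  φ : List Bool → ℤ → ℤ
  φ w x = + ones (take (x %ℕ n) w) + (x /ℕ n) * + k

  φ-residue : ∀ w x {r} q → r < n → x ≡ + r + q * + n → φ w x ≡ + ones (take r w) + q * + k
  φ-residue w x q r<n eq with %ℕ-/ℕ-unique x q r<n eq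
  ... | refl , refl = refl

  φ-0 : ∀ w → φ w 0ℤ ≡ 0ℤ
  φ-0 w = φ-residue w 0ℤ 0ℤ (ℕ.>-nonZero⁻¹ n) refl

  φ-shift : ∀ w x q → φ w (x + q * + n) ≡ φ w x + q * + k
  φ-shift w x q = trans (φ-residue w (x + q * + n) (x /ℕ n + q) (n%ℕd<d x n) x+qn≡)
                        (regroup (+ ones (take (x %ℕ n) w)) (x /ℕ n) q (+ k))
    where
      x+qn≡ : x + q * + n ≡ + (x %ℕ n) + (x /ℕ n + q) * + n
      x+qn≡ = trans (cong (_+ q * + n) (a≡a%ℕn+[a/ℕn]*n x n)) (regroup′ (+ (x %ℕ n)) (x /ℕ n) q (+ n))
        where
          regroup′ : ∀ a b q n → a + b * n + q * n ≡ a + (b + q) * n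
          regroup′ = solve-∀
      regroup : ∀ a b q k → a + (b + q) * k ≡ a + b * k + q * k
      regroup = solve-∀

  -- Residue n is allowed because the word has exactly k ones, so φ_n = k = φ_0 + k.
  φ-≤n : ∀ {w} → Is01Word k n w → ∀ {i} q → i ≤ n → φ w (+ i + q * + n) ≡ + ones (take i w) + q * + k
  φ-≤n {w} _ {i} q i≤n with ℕ.m≤n⇒m<n∨m≡n i≤n
  ... | inj₁ i<n = φ-residue w (+ i + q * + n) q i<n refl
  φ-≤n {w} (length≡n , ones≡k) q _ | inj₂ refl = begin
    φ w (+ n + q * + n)
      ≡⟨ φ-residue w (+ n + q * + n) (q + 1ℤ) (ℕ.>-nonZero⁻¹ n) (next-period (+ n) q) ⟩
    + 0 + (q + 1ℤ) * + k
      ≡⟨ next-period (+ k) q ⟨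
    + k + q * + k
      ≡⟨ cong (λ o → + o + q * + k) (trans (ones-take-≥ w (ℕ.≤-reflexive length≡n)) ones≡k) ⟨
    + ones (take n w) + q * + k ∎
    where
      open ≡-Reasoning
      next-period : ∀ m q → m + q * m ≡ + 0 + (q + 1ℤ) * m
      next-period = solve-∀

  φ-reverse : ∀ {w} → Is01Word k n w → ∀ x → φ (reverse w) x ≡ - φ w (- x)
  φ-reverse {w} w01@(length≡n , ones≡k) x = begin
    + ones (take r (reverse w)) + q * + k         ≡⟨ cong (_+ q * + k) complement ⟩
    (+ k - + ones (take (n ∸ r) w)) + q * + k     ≡⟨ regroup (+ k) (+ ones (take (n ∸ r) w)) q ⟩
    - (+ ones (take (n ∸ r) w) + (- q - 1ℤ) * + k) ≡⟨ cong -_ (φ-≤n w01 (- q - 1ℤ) (ℕ.m∸n≤m n r) ) ⟨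
    - φ w (+ (n ∸ r) + (- q - 1ℤ) * + n)          ≡⟨ cong (λ y → - φ w y) -x≡ ⟨
    - φ w (- x)                                   ∎
    where
      open ≡-Reasoning
      r = x %ℕ n
      q = x /ℕ n
      r≤n : r ≤ n
      r≤n = ℕ.<⇒≤ (n%ℕd<d x n)
      complement : + ones (take r (reverse w)) ≡ + k - + ones (take (n ∸ r) w)
      complement = pos-+-cancel (begin
        ones (take r (reverse w)) ℕ.+ ones (take (n ∸ r) w)
          ≡⟨ cong (λ m → ones (take r (reverse w)) ℕ.+ ones (take (m ∸ r) w)) length≡n ⟨
        ones (take r (reverse w)) ℕ.+ ones (take (length w ∸ r) w)
          ≡⟨ ones-take-reverse w (subst (r ≤_) (sym length≡n) r≤n) ⟩
        ones w
          ≡⟨ ones≡k ⟩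
        k ∎)
      -x≡ : - x ≡ + (n ∸ r) + (- q - 1ℤ) * + n
      -x≡ = trans (cong -_ (a≡a%ℕn+[a/ℕn]*n x n))
                  (trans (negate (+ r) q (+ n)) (cong (_+ (- q - 1ℤ) * + n) (sym (pos-∸ r≤n))))
        where
          negate : ∀ r q n → - (r + q * n) ≡ (n - r) + (- q - 1ℤ) * n
          negate = solve-∀
      regroup : ∀ k o q → (k - o) + q * k ≡ - (o + (- q - 1ℤ) * k)
      regroup = solve-∀

  φ-rotate : ∀ {w} → Is01Word k n w → ∀ x → φ (rotate w) x ≡ φ w (x + 1ℤ) - φ w 1ℤ
  φ-rotate {[]} (length≡n , _) x = ⊥-elim (ℕ.≢-nonZero⁻¹ n (sym length≡n))
  φ-rotate {h ∷ t} w01@(length≡n , _) x = sym (begin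
    φ (h ∷ t) (x + 1ℤ) - φ (h ∷ t) 1ℤ
      ≡⟨ cong₂ _-_ (trans (cong (φ (h ∷ t)) x+1≡) (φ-≤n w01 q r<n)) (φ-≤n w01 0ℤ (ℕ.>-nonZero⁻¹ n)) ⟩
    (+ (bit h ℕ.+ o) + q * + k) - (+ (bit h ℕ.+ 0) + 0ℤ * + k)
      ≡⟨ cong₂ (λ u v → (u + q * + k) - (v + 0ℤ * + k)) (ℤ.pos-+ (bit h) o) (ℤ.pos-+ (bit h) 0) ⟩
    (+ bit h + + o + q * + k) - (+ bit h + 0ℤ + 0ℤ * + k)
      ≡⟨ cancel (+ bit h) (+ o) q (+ k) ⟩
    + o + q * + k
      ≡⟨ cong (λ o → + o + q * + k) drop-last ⟨
    φ (rotate (h ∷ t)) x ∎)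
    where
      open ≡-Reasoning
      r = x %ℕ n
      q = x /ℕ n
      o = ones (take r t)
      r<n : r < n
      r<n = n%ℕd<d x n
      x+1≡ : x + 1ℤ ≡ + suc r + q * + n
      x+1≡ = trans (cong (_+ 1ℤ) (a≡a%ℕn+[a/ℕn]*n x n)) (shift (+ r) q (+ n))
        where
          shift : ∀ r q n → r + q * n + 1ℤ ≡ (1ℤ + r) + q * n
          shift = solve-∀
      cancel : ∀ b o q k → (b + o + q * k) - (b + 0ℤ + 0ℤ * k) ≡ o + q * k
      cancel = solve-∀
      drop-last : ones (take r (t ++ [ h ])) ≡ o
      drop-last = begin
        ones (take r (t ++ [ h ]))              ≡⟨ ones-take-++ r t [ h ] ⟩
        o ℕ.+ ones (take (r ∸ length t) [ h ])  ≡⟨ cong (λ m → o ℕ.+ ones (take m [ h ])) r∸length≡0 ⟩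
        o ℕ.+ 0                                 ≡⟨ ℕ.+-identityʳ o ⟩
        o                                       ∎
        where
          r∸length≡0 : r ∸ length t ≡ 0
          r∸length≡0 = ℕ.m≤n⇒m∸n≡0 (ℕ.≤-pred (subst (suc r ≤_) (sym length≡n) r<n))

  φ-rotate^ : ∀ {w} → Is01Word k n w → ∀ j x → φ (rotate^ j w) x ≡ φ w (x + + j) - φ w (+ j)
  φ-rotate^ {w} _ zero x = sym (trans (cong₂ _-_ (cong (φ w) (ℤ.+-identityʳ x)) (φ-0 w)) (ℤ.+-identityʳ (φ w x)))
  φ-rotate^ {w} w01 (suc j) x = begin
    φ (rotate v) x
      ≡⟨ φ-rotate (Is01Word-↭ (rotate^-↭ j w) w01) x ⟩
    φ v (x + 1ℤ) - φ v 1ℤ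
      ≡⟨ cong₂ _-_ (φ-rotate^ w01 j (x + 1ℤ)) (φ-rotate^ w01 j 1ℤ) ⟩
    (φ w (x + 1ℤ + + j) - φ w (+ j)) - (φ w (1ℤ + + j) - φ w (+ j))
      ≡⟨ cancel (φ w (x + 1ℤ + + j)) (φ w (+ j)) (φ w (1ℤ + + j)) ⟩
    φ w (x + 1ℤ + + j) - φ w (1ℤ + + j)
      ≡⟨ cong (λ a → φ w a - φ w (+ suc j)) (ℤ.+-assoc x 1ℤ (+ j)) ⟩
    φ w (x + + suc j) - φ w (+ suc j) ∎
    where
      open ≡-Reasoning
      v = rotate^ j w
      cancel : ∀ a b c → (a - b) - (c - b) ≡ a - c
      cancel = solve-∀

ones-replicate-false : ∀ m → ones (replicate m false) ≡ 0
ones-replicate-false zero = refl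
ones-replicate-false (suc m) = ones-replicate-false m

zeros-replicate-false : ∀ m → zeros (replicate m false) ≡ m
zeros-replicate-false zero = refl
zeros-replicate-false (suc m) = cong suc (zeros-replicate-false m)

wordAux-∷ʳ : ∀ top prev xs y → wordAux top prev (xs ++ [ y ]) ≡ wordAux y prev xs ++ true ∷ replicate (top ∸ y) false
wordAux-∷ʳ top prev [] y = refl
wordAux-∷ʳ top prev (x ∷ xs) y =
  trans (cong (λ w → replicate (x ∸ prev) false ++ true ∷ w) (wordAux-∷ʳ top x xs y))
        (sym (List.++-assoc (replicate (x ∸ prev) false) (true ∷ wordAux y x xs) _))

wordAux-reverse-∷ : ∀ t x xs →
                    wordAux t 0 (reverse (x ∷ xs)) ≡ wordAux x 0 (reverse xs) ++ true ∷ replicate (t ∸ x) false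
wordAux-reverse-∷ t x xs = trans (cong (wordAux t 0) (List.unfold-reverse x xs)) (wordAux-∷ʳ t 0 (reverse xs) x)

ones-wordAux : ∀ t l → ones (wordAux t 0 (reverse l)) ≡ length l
ones-wordAux t [] = ones-replicate-false t
ones-wordAux t (x ∷ xs) = begin
  ones (wordAux t 0 (reverse (x ∷ xs)))
    ≡⟨ cong ones (wordAux-reverse-∷ t x xs) ⟩
  ones (wordAux x 0 (reverse xs) ++ true ∷ replicate (t ∸ x) false)
    ≡⟨ ones-++ (wordAux x 0 (reverse xs)) _ ⟩
  ones (wordAux x 0 (reverse xs)) ℕ.+ suc (ones (replicate (t ∸ x) false))
    ≡⟨ cong₂ (λ a b → a ℕ.+ suc b) (ones-wordAux x xs) (ones-replicate-false (t ∸ x)) ⟩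
  length xs ℕ.+ 1
    ≡⟨ ℕ.+-comm (length xs) 1 ⟩
  length (x ∷ xs) ∎
  where open ≡-Reasoning

zeros-wordAux : ∀ t l → Linked _≥_ (t ∷ l) → zeros (wordAux t 0 (reverse l)) ≡ t
zeros-wordAux t [] _ = zeros-replicate-false t
zeros-wordAux t (x ∷ xs) (t≥x ∷ xs≤x) = begin
  zeros (wordAux t 0 (reverse (x ∷ xs)))
    ≡⟨ cong zeros (wordAux-reverse-∷ t x xs) ⟩
  ones (map not (wordAux x 0 (reverse xs) ++ true ∷ replicate (t ∸ x) false))
    ≡⟨ cong ones (List.map-++ not (wordAux x 0 (reverse xs)) _) ⟩
  ones (map not (wordAux x 0 (reverse xs)) ++ map not (true ∷ replicate (t ∸ x) false))
    ≡⟨ ones-++ (map not (wordAux x 0 (reverse xs))) _ ⟩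
  zeros (wordAux x 0 (reverse xs)) ℕ.+ zeros (replicate (t ∸ x) false)
    ≡⟨ cong₂ ℕ._+_ (zeros-wordAux x xs xs≤x) (zeros-replicate-false (t ∸ x)) ⟩
  x ℕ.+ (t ∸ x)
    ≡⟨ ℕ.m+[n∸m]≡n t≥x ⟩
  t ∎
  where open ≡-Reasoning

length-wordAux : ∀ t l → Linked _≥_ (t ∷ l) → length (wordAux t 0 (reverse l)) ≡ t ℕ.+ length l
length-wordAux t l l≤t =
  trans (length≡zeros+ones (wordAux t 0 (reverse l))) (cong₂ ℕ._+_ (zeros-wordAux t l l≤t) (ones-wordAux t l))

IsPart⇒bounded : ∀ {k n l} → IsPart k n l → Linked _≥_ (n ∸ k ∷ l)
IsPart⇒bounded {l = []} _ = [-]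
IsPart⇒bounded {l = x ∷ xs} (_ , decreasing , x≤n-k ∷ _) = x≤n-k ∷ decreasing

zeros-word : ∀ {k n l} → IsPart k n l → zeros (word k n l) ≡ n ∸ k
zeros-word {k} {n} {l} p = zeros-wordAux (n ∸ k) l (IsPart⇒bounded p)

word-Is01Word : ∀ {k n l} → k ≤ n → IsPart k n l → Is01Word k n (word k n l)
word-Is01Word {k} {n} {l} k≤n p@(length≡k , _) = length≡n , trans (ones-wordAux (n ∸ k) l) length≡k
  where
    length≡n : length (word k n l) ≡ n
    length≡n = trans (length-wordAux (n ∸ k) l (IsPart⇒bounded p))
                     (trans (cong ((n ∸ k) ℕ.+_) length≡k) (ℕ.m∸n+n≡m k≤n))

indicator-complement : ∀ {P Q : Set} (p : Dec P) (q : Dec Q) → (P → ¬ Q) → (¬ P → Q) →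
                       (if does p then 1 else 0) ℕ.+ (if does q then 1 else 0) ≡ 1
indicator-complement (yes a) q P⇒¬Q _ = cong (λ b → 1 ℕ.+ (if b then 1 else 0)) (dec-false q (P⇒¬Q a))
indicator-complement (no ¬a) q _ ¬P⇒Q = cong (λ b → if b then 1 else 0) (dec-true q (¬P⇒Q ¬a))

-- The up step of a row of length x lying above the rows xs is letter number x + length xs + 1 of the word.
upStepsWithin : ℕ → List ℕ → ℕ
upStepsWithin s [] = 0
upStepsWithin s (x ∷ xs) = (if does (x ℕ.+ length xs ℕ.<? s) then 1 else 0) ℕ.+ upStepsWithin s xs

ones-take-∸-up-step : ∀ a s r → ones (take (s ∸ a) (true ∷ replicate r false)) ≡ (if does (a ℕ.<? s) then 1 else 0)
ones-take-∸-up-step a s r with s ∸ a in eq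
... | zero = sym (cong (λ b → if b then 1 else 0) (dec-false (a ℕ.<? s) (λ a<s → ℕ.m>n⇒m∸n≢0 a<s eq)))
... | suc m = trans (cong suc (ones-take-replicate-false m r)) (sym (cong (λ b → if b then 1 else 0) (dec-true (a ℕ.<? s) a<s)))
  where
    a<s : a < s
    a<s = ℕ.m∸n≢0⇒n<m (λ s∸a≡0 → ℕ.1+n≢0 (trans (sym eq) s∸a≡0))

ones-take-wordAux : ∀ s t l → Linked _≥_ (t ∷ l) → ones (take s (wordAux t 0 (reverse l))) ≡ upStepsWithin s l
ones-take-wordAux s t [] _ = ones-take-replicate-false s t
ones-take-wordAux s t (x ∷ xs) (t≥x ∷ xs≤x) = begin
  ones (take s (wordAux t 0 (reverse (x ∷ xs))))
    ≡⟨ cong (λ w → ones (take s w)) (wordAux-reverse-∷ t x xs) ⟩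
  ones (take s (u ++ up-step))
    ≡⟨ ones-take-++ s u up-step ⟩
  ones (take s u) ℕ.+ ones (take (s ∸ length u) up-step)
    ≡⟨ cong₂ (λ a b → a ℕ.+ ones (take (s ∸ b) up-step)) (ones-take-wordAux s x xs xs≤x) (length-wordAux x xs xs≤x) ⟩
  upStepsWithin s xs ℕ.+ ones (take (s ∸ (x ℕ.+ length xs)) up-step)
    ≡⟨ cong (upStepsWithin s xs ℕ.+_) (ones-take-∸-up-step (x ℕ.+ length xs) s (t ∸ x)) ⟩
  upStepsWithin s xs ℕ.+ (if does (x ℕ.+ length xs ℕ.<? s) then 1 else 0)
    ≡⟨ ℕ.+-comm (upStepsWithin s xs) _ ⟩
  upStepsWithin s (x ∷ xs)                                         ∎
  where
    open ≡-Reasoning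
    u = wordAux x 0 (reverse xs)
    up-step = true ∷ replicate (t ∸ x) false

-- Row j satisfies λⱼ ≥ i + j exactly when its up step lies beyond letter length l + i.
diag0From+upStepsWithin : ∀ i l → diag0From (suc i) l ℕ.+ upStepsWithin (length l ℕ.+ i) l ≡ length l
diag0From+upStepsWithin i [] = refl
diag0From+upStepsWithin i (x ∷ xs) = begin
  (on-diagonal ℕ.+ diag0From (suc (suc i)) xs) ℕ.+ (below ℕ.+ upStepsWithin (suc (length xs ℕ.+ i)) xs)
    ≡⟨ cong (λ s → (on-diagonal ℕ.+ diag0From (suc (suc i)) xs) ℕ.+ (below ℕ.+ upStepsWithin s xs))
            (ℕ.+-suc (length xs) i) ⟨
  (on-diagonal ℕ.+ diag0From (suc (suc i)) xs) ℕ.+ (below ℕ.+ upStepsWithin (length xs ℕ.+ suc i) xs)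
    ≡⟨ interchange on-diagonal (diag0From (suc (suc i)) xs) below _ ⟩
  (on-diagonal ℕ.+ below) ℕ.+ (diag0From (suc (suc i)) xs ℕ.+ upStepsWithin (length xs ℕ.+ suc i) xs)
    ≡⟨ cong₂ ℕ._+_ exactly-one (diag0From+upStepsWithin (suc i) xs) ⟩
  suc (length xs) ∎
  where
    open ≡-Reasoning
    on-diagonal = if does (suc i ℕ.≤? x) then 1 else 0
    below = if does (x ℕ.+ length xs ℕ.<? suc (length xs ℕ.+ i)) then 1 else 0
    interchange : ∀ a d b u → (a ℕ.+ d) ℕ.+ (b ℕ.+ u) ≡ (a ℕ.+ b) ℕ.+ (d ℕ.+ u)
    interchange = ℕ-Solver.solve-∀
    below⇒x≤i : x ℕ.+ length xs < suc (length xs ℕ.+ i) → x ≤ i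
    below⇒x≤i lt =
      ℕ.+-cancelʳ-≤ (length xs) x i (subst (x ℕ.+ length xs ≤_) (ℕ.+-comm (length xs) i) (ℕ.≤-pred lt))
    x≤i⇒below : x ≤ i → x ℕ.+ length xs < suc (length xs ℕ.+ i)
    x≤i⇒below x≤i = s≤s (subst (x ℕ.+ length xs ≤_) (ℕ.+-comm i (length xs)) (ℕ.+-monoˡ-≤ (length xs) x≤i))
    exactly-one : on-diagonal ℕ.+ below ≡ 1
    exactly-one = indicator-complement (suc i ℕ.≤? x) (x ℕ.+ length xs ℕ.<? suc (length xs ℕ.+ i))
                    (λ i<x lt → ℕ.<⇒≱ i<x (below⇒x≤i lt)) (λ i≮x → x≤i⇒below (ℕ.≮⇒≥ i≮x))

diag0+ones-take-word : ∀ {k n l} → IsPart k n l → diag0 l ℕ.+ ones (take k (word k n l)) ≡ k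
diag0+ones-take-word {k} {n} {l} p@(length≡k , _) = begin
  diag0 l ℕ.+ ones (take k (word k n l))
    ≡⟨ cong (diag0 l ℕ.+_) (ones-take-wordAux k (n ∸ k) l (IsPart⇒bounded p)) ⟩
  diag0 l ℕ.+ upStepsWithin k l
    ≡⟨ cong (λ s → diag0 l ℕ.+ upStepsWithin s l) (trans (sym length≡k) (sym (ℕ.+-identityʳ (length l)))) ⟩
  diag0From 1 l ℕ.+ upStepsWithin (length l ℕ.+ 0) l
    ≡⟨ diag0From+upStepsWithin 0 l ⟩
  length l
    ≡⟨ length≡k ⟩
  k ∎
  where open ≡-Reasoning

replicate-∷ʳ : ∀ {A : Set} m (x : A) → replicate m x ++ [ x ] ≡ x ∷ replicate m x
replicate-∷ʳ zero x = refl
replicate-∷ʳ (suc m) x = cong (x ∷_) (replicate-∷ʳ m x)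

reverse-replicate : ∀ {A : Set} m (x : A) → reverse (replicate m x) ≡ replicate m x
reverse-replicate zero x = refl
reverse-replicate (suc m) x = begin
  reverse (x ∷ replicate m x)       ≡⟨ List.unfold-reverse x (replicate m x) ⟩
  reverse (replicate m x) ++ [ x ]  ≡⟨ cong (_++ [ x ]) (reverse-replicate m x) ⟩
  replicate m x ++ [ x ]            ≡⟨ replicate-∷ʳ m x ⟩
  x ∷ replicate m x                 ∎
  where open ≡-Reasoning

∸-∸-∸ : ∀ {c t x} → x ≤ t → t ≤ c → (c ∸ x) ∸ (c ∸ t) ≡ t ∸ x
∸-∸-∸ {c} {t} {x} x≤t t≤c = begin
  (c ∸ x) ∸ (c ∸ t)                 ≡⟨ cong (λ m → (m ∸ x) ∸ (c ∸ t)) (ℕ.m∸n+n≡m t≤c) ⟨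
  ((c ∸ t) ℕ.+ t ∸ x) ∸ (c ∸ t)     ≡⟨ cong (_∸ (c ∸ t)) (ℕ.+-∸-assoc (c ∸ t) x≤t) ⟩
  ((c ∸ t) ℕ.+ (t ∸ x)) ∸ (c ∸ t)   ≡⟨ ℕ.m+n∸m≡n (c ∸ t) (t ∸ x) ⟩
  t ∸ x                             ∎
  where open ≡-Reasoning

-- Reading the boundary path backwards is reading the boundary of the complementary partition in the c-wide rectangle.
reverse-wordAux : ∀ c t l → t ≤ c → Linked _≥_ (t ∷ l) →
                  reverse (wordAux t 0 (reverse l)) ≡ wordAux c (c ∸ t) (map (c ∸_) l)
reverse-wordAux c t [] t≤c _ =
  trans (reverse-replicate t false) (cong (λ m → replicate m false) (sym (ℕ.m∸[m∸n]≡n t≤c)))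
reverse-wordAux c t (x ∷ xs) t≤c (t≥x ∷ xs≤x) = begin
  reverse (wordAux t 0 (reverse (x ∷ xs)))
    ≡⟨ cong reverse (wordAux-reverse-∷ t x xs) ⟩
  reverse (wordAux x 0 (reverse xs) ++ true ∷ replicate (t ∸ x) false)
    ≡⟨ List.reverse-++ (wordAux x 0 (reverse xs)) _ ⟩
  reverse (true ∷ replicate (t ∸ x) false) ++ reverse (wordAux x 0 (reverse xs))
    ≡⟨ cong₂ _++_ (trans (List.unfold-reverse true (replicate (t ∸ x) false))
                         (cong (_++ [ true ]) (reverse-replicate (t ∸ x) false)))
                  (reverse-wordAux c x xs (ℕ.≤-trans t≥x t≤c) xs≤x) ⟩
  (replicate (t ∸ x) false ++ [ true ]) ++ wordAux c (c ∸ x) (map (c ∸_) xs)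
    ≡⟨ List.++-assoc (replicate (t ∸ x) false) [ true ] _ ⟩
  replicate (t ∸ x) false ++ true ∷ wordAux c (c ∸ x) (map (c ∸_) xs)
    ≡⟨ cong (λ m → replicate m false ++ true ∷ wordAux c (c ∸ x) (map (c ∸_) xs)) (∸-∸-∸ t≥x t≤c) ⟨
  wordAux c (c ∸ t) (map (c ∸_) (x ∷ xs)) ∎
  where open ≡-Reasoning

word-dual : ∀ {k n l} → IsPart k n l → word k n (dual k n l) ≡ reverse (word k n l)
word-dual {k} {n} {l} p = begin
  wordAux c 0 (reverse (reverse (map (c ∸_) l)))  ≡⟨ cong (wordAux c 0) (List.reverse-involutive (map (c ∸_) l)) ⟩
  wordAux c 0 (map (c ∸_) l)                      ≡⟨ cong (λ m → wordAux c m (map (c ∸_) l)) (ℕ.n∸n≡0 c) ⟨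
  wordAux c (c ∸ c) (map (c ∸_) l)                ≡⟨ reverse-wordAux c c l ℕ.≤-refl (IsPart⇒bounded p) ⟨
  reverse (word k n l)                            ∎
  where
    open ≡-Reasoning
    c = n ∸ k

replicate-suc-++ : ∀ {A : Set} m (x : A) w → replicate (suc m) x ++ w ≡ replicate m x ++ x ∷ w
replicate-suc-++ zero x w = refl
replicate-suc-++ (suc m) x w = cong (x ∷_) (replicate-suc-++ m x w)

-- z counts the right steps read so far, p is the length of the row below.
wordAux-fromWordAux : ∀ top p z w → p ≤ z → z ℕ.+ zeros w ≡ top →
                      wordAux top p (fromWordAux z w) ≡ replicate (z ∸ p) false ++ w
wordAux-fromWordAux top p z [] p≤z z≡top =
  trans (cong (λ m → replicate (m ∸ p) false) (trans (sym z≡top) (ℕ.+-identityʳ z))) (sym (List.++-identityʳ _))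
wordAux-fromWordAux top p z (false ∷ w) p≤z z+zeros≡top = begin
  wordAux top p (fromWordAux (suc z) w)
    ≡⟨ wordAux-fromWordAux top p (suc z) w (ℕ.m≤n⇒m≤1+n p≤z) (trans (sym (ℕ.+-suc z (zeros w))) z+zeros≡top) ⟩
  replicate (suc z ∸ p) false ++ w
    ≡⟨ cong (λ m → replicate m false ++ w) (ℕ.+-∸-assoc 1 p≤z) ⟩
  replicate (suc (z ∸ p)) false ++ w
    ≡⟨ replicate-suc-++ (z ∸ p) false w ⟩
  replicate (z ∸ p) false ++ false ∷ w ∎
  where open ≡-Reasoning
wordAux-fromWordAux top p z (true ∷ w) p≤z z+zeros≡top =
  cong (λ v → replicate (z ∸ p) false ++ true ∷ v)
       (trans (wordAux-fromWordAux top z z w ℕ.≤-refl z+zeros≡top)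
              (cong (λ m → replicate m false ++ w) (ℕ.n∸n≡0 z)))

word-fromWord : ∀ k n w → zeros w ≡ n ∸ k → word k n (fromWord w) ≡ w
word-fromWord k n w zeros≡ =
  trans (cong (wordAux (n ∸ k) 0) (List.reverse-involutive (fromWordAux 0 w)))
        (wordAux-fromWordAux (n ∸ k) 0 0 w z≤n zeros≡)

word-Spow-dual : ∀ {k n l} → IsPart k n l → ∀ j →
                 word k n (Spow k n j (dual k n l)) ≡ rotate^ j (reverse (word k n l))
word-Spow-dual p zero = word-dual p
word-Spow-dual {k} {n} {l} p (suc j) = begin
  word k n (fromWord (rotate (word k n (Spow k n j (dual k n l)))))
    ≡⟨ cong (λ v → word k n (fromWord (rotate v))) (word-Spow-dual p j) ⟩
  word k n (fromWord (rotate^ (suc j) w))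
    ≡⟨ word-fromWord k n (rotate^ (suc j) w) zeros≡ ⟩
  rotate^ (suc j) w ∎
  where
    open ≡-Reasoning
    w = reverse (word k n l)
    zeros≡ : zeros (rotate^ (suc j) w) ≡ n ∸ k
    zeros≡ = trans (zeros-↭ (↭-trans (rotate^-↭ (suc j) w) (↭-reverse (word k n l)))) (zeros-word p)

minUpTo-≤ : ∀ f {m i} → i ≤ m → minUpTo f m ℤ.≤ f i
minUpTo-≤ f {zero} z≤n = ℤ.≤-refl
minUpTo-≤ f {suc m} i≤1+m with ℕ.m≤n⇒m<n∨m≡n i≤1+m
... | inj₁ i<1+m = ℤ.≤-trans (ℤ.i⊓j≤j (f (suc m)) _) (minUpTo-≤ f (ℕ.≤-pred i<1+m))
... | inj₂ refl = ℤ.i⊓j≤i (f (suc m)) _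

minUpTo-attained : ∀ f m → ∃[ i ] i ≤ m × minUpTo f m ≡ f i
minUpTo-attained f zero = 0 , z≤n , refl
minUpTo-attained f (suc m) with ℤ.≤-total (f (suc m)) (minUpTo f m) | minUpTo-attained f m
... | inj₁ new≤ | _ = suc m , ℕ.≤-refl , ℤ.i≤j⇒i⊓j≡i new≤
... | inj₂ old≤ | i , i≤m , min≡ = i , ℕ.m≤n⇒m≤1+n i≤m , trans (ℤ.i≥j⇒i⊓j≡j old≤) min≡

minUpTo-cong : ∀ {f g} m → (∀ i → f i ≡ g i) → minUpTo f m ≡ minUpTo g m
minUpTo-cong zero f≗g = f≗g 0
minUpTo-cong (suc m) f≗g = cong₂ _⊓_ (f≗g (suc m)) (minUpTo-cong m f≗g)

maxUpTo-cong : ∀ {f g} m → (∀ i → f i ≡ g i) → maxUpTo f m ≡ maxUpTo g m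
maxUpTo-cong zero f≗g = f≗g 0
maxUpTo-cong (suc m) f≗g = cong₂ _⊔_ (f≗g (suc m)) (maxUpTo-cong m f≗g)

minUpTo-values-⊆ : ∀ f g m → (∀ i → i ≤ m → ∃[ i′ ] i′ ≤ m × f i ≡ g i′) →
                   minUpTo g m ℤ.≤ minUpTo f m
minUpTo-values-⊆ f g m f⊆g with minUpTo-attained f m
... | i , i≤m , min≡ with f⊆g i i≤m
... | i′ , i′≤m , fi≡gi′ = subst (minUpTo g m ℤ.≤_) (sym (trans min≡ fi≡gi′)) (minUpTo-≤ g i′≤m)

maxUpTo≡-minUpTo-neg : ∀ f m → maxUpTo f m ≡ - minUpTo (λ i → - f i) m
maxUpTo≡-minUpTo-neg f zero = sym (ℤ.neg-involutive (f 0))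
maxUpTo≡-minUpTo-neg f (suc m) = begin
  f (suc m) ⊔ maxUpTo f m
    ≡⟨ cong₂ _⊔_ (sym (ℤ.neg-involutive (f (suc m)))) (maxUpTo≡-minUpTo-neg f m) ⟩
  - - f (suc m) ⊔ - minUpTo (λ i → - f i) m
    ≡⟨ ℤ.neg-distrib-⊓-⊔ (- f (suc m)) _ ⟨
  - (- f (suc m) ⊓ minUpTo (λ i → - f i) m) ∎
  where open ≡-Reasoning

sub-antimonoʳ-< : ∀ a {x y} → x ℤ.< y → a - y ℤ.< a - x
sub-antimonoʳ-< a x<y = ℤ.+-monoʳ-< a (ℤ.neg-mono-< x<y)

minUpTo-const-sub : ∀ a f m → minUpTo (λ i → a - f i) m ≡ a - maxUpTo f m
minUpTo-const-sub a f zero = refl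
minUpTo-const-sub a f (suc m) =
  trans (cong ((a - f (suc m)) ⊓_) (minUpTo-const-sub a f m))
        (sym (ℤ.antimono-<-distrib-⊔ (_-_ a) (sub-antimonoʳ-< a) (f (suc m)) (maxUpTo f m)))

maxUpTo-const-sub : ∀ a f m → maxUpTo (λ i → a - f i) m ≡ a - minUpTo f m
maxUpTo-const-sub a f zero = refl
maxUpTo-const-sub a f (suc m) =
  trans (cong ((a - f (suc m)) ⊔_) (maxUpTo-const-sub a f m))
        (sym (ℤ.antimono-<-distrib-⊓ (_-_ a) (sub-antimonoʳ-< a) (f (suc m)) (minUpTo f m)))

-- Over one period, i ↦ c - i runs through every residue class exactly once.
minUpTo-periodic-reflect : ∀ {n} .{{_ : NonZero n}} {F : ℤ → ℤ} → Periodic n F → ∀ c →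
                           minUpTo (λ i → F (c - + i)) (n ∸ 1) ≡ minUpTo (λ i → F (+ i)) (n ∸ 1)
minUpTo-periodic-reflect {n} {F} F-periodic c =
  ℤ.≤-antisym (minUpTo-values-⊆ _ _ (n ∸ 1) residue-reflected) (minUpTo-values-⊆ _ _ (n ∸ 1) reflected-residue)
  where
    residue-reflected : ∀ i → i ≤ n ∸ 1 → ∃[ i′ ] i′ ≤ n ∸ 1 × F (+ i) ≡ F (c - + i′)
    residue-reflected i _ = r , ℕ.<⇒≤pred (n%ℕd<d (c - + i) n) , sym (trans (cong F c-r≡) (F-periodic (+ i) q))
      where
        r = (c - + i) %ℕ n
        q = (c - + i) /ℕ n
        swap : ∀ c i r qn → c - i ≡ r + qn → c - r ≡ i + qn
        swap c i r qn eq = trans (trans (regroup c i r) (cong (λ x → x + i - r) eq)) (cancel r qn i)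
          where
            regroup : ∀ c i r → c - r ≡ (c - i) + i - r
            regroup = solve-∀
            cancel : ∀ r qn i → (r + qn) + i - r ≡ i + qn
            cancel = solve-∀
        c-r≡ : c - + r ≡ + i + q * + n
        c-r≡ = swap c (+ i) (+ r) (q * + n) (a≡a%ℕn+[a/ℕn]*n (c - + i) n)
    reflected-residue : ∀ i → i ≤ n ∸ 1 → ∃[ i′ ] i′ ≤ n ∸ 1 × F (c - + i) ≡ F (+ i′)
    reflected-residue i _ = (c - + i) %ℕ n , ℕ.<⇒≤pred (n%ℕd<d (c - + i) n) ,
      trans (cong F (a≡a%ℕn+[a/ℕn]*n (c - + i) n)) (F-periodic (+ ((c - + i) %ℕ n)) ((c - + i) /ℕ n))

maxUpTo-periodic-reflect : ∀ {n} .{{_ : NonZero n}} {F : ℤ → ℤ} → Periodic n F → ∀ c →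
                           maxUpTo (λ i → F (c - + i)) (n ∸ 1) ≡ maxUpTo (λ i → F (+ i)) (n ∸ 1)
maxUpTo-periodic-reflect {n} {F} F-periodic c = begin
  maxUpTo (λ i → F (c - + i)) (n ∸ 1)         ≡⟨ maxUpTo≡-minUpTo-neg _ (n ∸ 1) ⟩
  - minUpTo (λ i → - F (c - + i)) (n ∸ 1)     ≡⟨ cong -_ (minUpTo-periodic-reflect -F-periodic c) ⟩
  - minUpTo (λ i → - F (+ i)) (n ∸ 1)         ≡⟨ maxUpTo≡-minUpTo-neg _ (n ∸ 1) ⟨
  maxUpTo (λ i → F (+ i)) (n ∸ 1)             ∎
  where
    open ≡-Reasoning
    -F-periodic : Periodic n (λ y → - F y)
    -F-periodic y q = cong -_ (F-periodic y q)

module Duality (k n : ℕ) .{{_ : NonZero n}} (k<n : k < n) {l m : List ℕ} (pl : IsPart k n l) (pm : IsPart k n m) where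

  open PeriodicExtension k n

  private
    wl = word k n l
    wm = word k n m
    d = diag0 l
    L = Spow k n (n ∸ k) (dual k n l)
    M = dual k n m
    c = + k - + n
    wl-01 = word-Is01Word (ℕ.<⇒≤ k<n) pl
    wm-01 = word-Is01Word (ℕ.<⇒≤ k<n) pm

  pairing : ℤ → ℤ → ℤ
  pairing a y = φ wl y + φ wm (a - y)

  pairing-periodic : ∀ a → Periodic n (pairing a)
  pairing-periodic a y q = begin
    φ wl (y + q * + n) + φ wm (a - (y + q * + n))
      ≡⟨ cong (λ z → φ wl (y + q * + n) + φ wm z) (regroup a y q (+ n)) ⟩
    φ wl (y + q * + n) + φ wm ((a - y) + (- q) * + n)
      ≡⟨ cong₂ _+_ (φ-shift wl y q) (φ-shift wm (a - y) (- q)) ⟩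
    (φ wl y + q * + k) + (φ wm (a - y) + (- q) * + k)
      ≡⟨ cancel (φ wl y) (φ wm (a - y)) q (+ k) ⟩
    pairing a y ∎
    where
      open ≡-Reasoning
      regroup : ∀ a y q n → a - (y + q * n) ≡ (a - y) + (- q) * n
      regroup = solve-∀
      cancel : ∀ u v q k → (u + q * k) + (v + (- q) * k) ≡ u + v
      cancel = solve-∀

  φ-word-at-k-n : φ wl c ≡ - + d
  φ-word-at-k-n = begin
    φ wl c                               ≡⟨ cong (φ wl) (regroup (+ k) (+ n)) ⟩
    φ wl (+ k + (- 1ℤ) * + n)            ≡⟨ φ-≤n wl-01 (- 1ℤ) (ℕ.<⇒≤ k<n) ⟩
    + ones (take k wl) + (- 1ℤ) * + k    ≡⟨ cong (_+ (- 1ℤ) * + k) up-steps ⟩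
    (+ k - + d) + (- 1ℤ) * + k           ≡⟨ cancel (+ k) (+ d) ⟩
    - + d                                ∎
    where
      open ≡-Reasoning
      regroup : ∀ k n → k - n ≡ k + (- 1ℤ) * n
      regroup = solve-∀
      cancel : ∀ k d → (k - d) + (- 1ℤ) * k ≡ - d
      cancel = solve-∀
      up-steps : + ones (take k wl) ≡ + k - + d
      up-steps = pos-+-cancel (trans (ℕ.+-comm (ones (take k wl)) d) (diag0+ones-take-word pl))

  phi-Spow-dual : ∀ x → phi k n L x ≡ - φ wl (c - x) - + d
  phi-Spow-dual x = begin
    φ (word k n L) x
      ≡⟨ cong (λ w → φ w x) (word-Spow-dual pl (n ∸ k)) ⟩
    φ (rotate^ (n ∸ k) (reverse wl)) x
      ≡⟨ φ-rotate^ (Is01Word-↭ (↭-reverse wl) wl-01) (n ∸ k) x ⟩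
    φ (reverse wl) (x + + (n ∸ k)) - φ (reverse wl) (+ (n ∸ k))
      ≡⟨ cong₂ _-_ (φ-reverse wl-01 (x + + (n ∸ k))) (φ-reverse wl-01 (+ (n ∸ k))) ⟩
    - φ wl (- (x + + (n ∸ k))) - - φ wl (- (0ℤ + + (n ∸ k)))
      ≡⟨ cong₂ (λ y z → - φ wl y - - φ wl z) (to-c x) (to-c 0ℤ) ⟩
    - φ wl (c - x) - - φ wl (c - 0ℤ)
      ≡⟨ cong (λ y → - φ wl (c - x) - - y) (trans (cong (φ wl) (ℤ.+-identityʳ c)) φ-word-at-k-n) ⟩
    - φ wl (c - x) - - - + d
      ≡⟨ cong (λ z → - φ wl (c - x) - z) (ℤ.neg-involutive (+ d)) ⟩
    - φ wl (c - x) - + d ∎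
    where
      open ≡-Reasoning
      regroup : ∀ x n k → - (x + (n - k)) ≡ (k - n) - x
      regroup = solve-∀
      to-c : ∀ x → - (x + + (n ∸ k)) ≡ c - x
      to-c x = trans (cong (λ j → - (x + j)) (pos-∸ (ℕ.<⇒≤ k<n))) (regroup x (+ n) (+ k))

  phi-dual : ∀ y → phi k n M y ≡ - φ wm (- y)
  phi-dual y = trans (cong (λ w → φ w y) (word-dual pm)) (φ-reverse wm-01 y)

  phi-Spow-dual+phi-dual : ∀ a x y → a - (c - x) ≡ - y → phi k n L x + phi k n M y ≡ - + d - pairing a (c - x)
  phi-Spow-dual+phi-dual a x y eq = begin
    phi k n L x + phi k n M y                       ≡⟨ cong₂ _+_ (phi-Spow-dual x) (phi-dual y) ⟩
    (- φ wl (c - x) - + d) + - φ wm (- y)           ≡⟨ cong (λ z → (- φ wl (c - x) - + d) + - φ wm z) eq ⟨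
    (- φ wl (c - x) - + d) + - φ wm (a - (c - x))   ≡⟨ regroup (φ wl (c - x)) (+ d) (φ wm (a - (c - x))) ⟩
    - + d - pairing a (c - x)                       ∎
    where
      open ≡-Reasoning
      regroup : ∀ u d v → (- u - d) + - v ≡ - d - (u + v)
      regroup = solve-∀

  private
    negate-via : ∀ d x → - x ≡ d - - (- d - x)
    negate-via = solve-∀

  Dmin-duality : Dmin k n l m ≡ + d - Dmax k n L M
  Dmin-duality = begin
    - minUpTo (λ i → φ wl (+ i) + φ wm (- + i)) (n ∸ 1)
      ≡⟨ cong -_ (minUpTo-cong (n ∸ 1) λ i → cong (λ y → φ wl (+ i) + φ wm y) (sym (ℤ.+-identityˡ (- + i)))) ⟩
    - minUpTo (λ i → pairing 0ℤ (+ i)) (n ∸ 1)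
      ≡⟨ cong -_ (minUpTo-periodic-reflect (pairing-periodic 0ℤ) c) ⟨
    - minUpTo (λ i → pairing 0ℤ (c - + i)) (n ∸ 1)
      ≡⟨ negate-via (+ d) _ ⟩
    + d - - (- + d - minUpTo (λ i → pairing 0ℤ (c - + i)) (n ∸ 1))
      ≡⟨ cong (λ z → + d - - z) (maxUpTo-const-sub (- + d) _ (n ∸ 1)) ⟨
    + d - - maxUpTo (λ i → - + d - pairing 0ℤ (c - + i)) (n ∸ 1)
      ≡⟨ cong (λ z → + d - - z) (maxUpTo-cong (n ∸ 1) λ i → phi-Spow-dual+phi-dual 0ℤ (+ i) (c - + i) (ℤ.+-identityˡ _)) ⟨
    + d - Dmax k n L M ∎
    where open ≡-Reasoning

  Dmax-duality : Dmax k n l m ≡ + d - Dmin k n L M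
  Dmax-duality = begin
    - maxUpTo (λ i → pairing c (+ i)) (n ∸ 1)
      ≡⟨ cong -_ (maxUpTo-periodic-reflect (pairing-periodic c) c) ⟨
    - maxUpTo (λ i → pairing c (c - + i)) (n ∸ 1)
      ≡⟨ negate-via (+ d) _ ⟩
    + d - - (- + d - maxUpTo (λ i → pairing c (c - + i)) (n ∸ 1))
      ≡⟨ cong (λ z → + d - - z) (minUpTo-const-sub (- + d) _ (n ∸ 1)) ⟨
    + d - - minUpTo (λ i → - + d - pairing c (c - + i)) (n ∸ 1)
      ≡⟨ cong (λ z → + d - - z) (minUpTo-cong (n ∸ 1) λ i → phi-Spow-dual+phi-dual c (+ i) (- + i) (cancel c (+ i))) ⟨
    + d - Dmin k n L M ∎
    where
      open ≡-Reasoning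
      cancel : ∀ c i → c - (c - i) ≡ - - i
      cancel = solve-∀

-- The identities also hold for k = 0.
corollary8p3 : (k n : ℕ) → .{{_ : NonZero n}} → 1 ≤ k → k < n →
    (l m : List ℕ) → IsPart k n l → IsPart k n m →
    (Dmin k n l m ≡ + diag0 l - Dmax k n (Spow k n (n Data.Nat.∸ k) (dual k n l)) (dual k n m))
    × (Dmax k n l m ≡ + diag0 l - Dmin k n (Spow k n (n Data.Nat.∸ k) (dual k n l)) (dual k n m))
corollary8p3 k n _ k<n l m pl pm = Dmin-duality , Dmax-duality
  where open Duality k n k<n pl pm
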